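{- Let $n\ge1$, $0\le k<n$, and let $A,B\subseteq[n]$ with $|A|=|B|=k+1$. Then $$\mathrm{lm}_\preceq(\det M(A,B))=\prod_{(i,j)\in N(A,B)}x_{ij}.$$
   Context: $X=(x_{ij})_{1\le i,j\le n}$ is a matrix of indeterminates over a field $\mathbb K$. For $A,B\subseteq[n]$ of equal size, $M(A,B)=(x_{ij})_{i\in A,j\in B}$ is the corresponding submatrix. For $s\ge1$ and $A=\{a_1<\dots<a_s\}$, $B=\{b_1<\dots<b_s\}$, let $\ell$ be the least integer $0\le\ell\le s$ such that $a_{i+\ell}>b_i$ for all $1\le i\le s-\ell$. Then $N(A,B)=\{(a_{(i+\ell)\bmod s},b_i):i=1,\dots,s\}$, where $\bmod s$ takes values in $\{1,\dots,s\}$. Term order $\preceq$: let $\varphi(i,j)=\big[((2-i)n+(j-1)(n-1)-1)\bmod n^2\big]+1$, with the usual residue in $\{0,\dots,n^2-1\}$. This is a bijection $[n]^2\to[n^2]$. Order the variables by $x_{ij}\preceq x_{kl}$ iff $\varphi(i,j)\le\varphi(k,l)$. Then $\preceq$ is the degree reverse lexicographic order for this variable order: $m\prec m'$ if $\deg m<\deg m'$, or if the degrees are equal and, at the $\preceq$-smallest variable where the exponents differ, $m$ has the larger exponent. $\mathrm{lm}_\preceq(f)$ is the $\preceq$-largest monomial of $f$ with nonzero coefficient. -}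

module Defs where

open import Level using (Level; _⊔_) renaming (suc to lsuc)
open import Data.Nat as ℕ using (ℕ; zero; suc; _<_; _≤_; NonZero)
open import Data.Nat.DivMod using (_mod_)
open import Data.Integer as ℤ using (ℤ; +_; _%ℕ_)
open import Data.Fin as Fin using (Fin; toℕ)
open import Data.Fin.Properties as FinP using ()
open import Data.Bool using (if_then_else_)
open import Data.List as List using (List; []; _∷_; _++_; map; concatMap; foldr; allFin)
open import Data.Product using (_×_; _,_; Σ; ∃)
open import Data.Sum using (_⊎_)
open import Relation.Nullary using (¬_; Dec; yes; no; does)
open import Relation.Nullary.Decidable using (_×-dec_)
open import Relation.Binary.PropositionalEquality using (_≡_; _≢_)
open import Algebra.Bundles using (CommutativeRing)

record Field (c ℓ : Level) : Set (lsuc (c ⊔ ℓ)) where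
  field
    commutativeRing : CommutativeRing c ℓ
  open CommutativeRing commutativeRing public
  field
    1≉0     : ¬ (1# ≈ 0#)
    inverse : ∀ x → ¬ (x ≈ 0#) → Σ Carrier (λ y → x * y ≈ 1#)

sumFin : (s : ℕ) → (Fin s → ℕ) → ℕ
sumFin zero    f = 0
sumFin (suc s) f = f Fin.zero ℕ.+ sumFin s (λ i → f (Fin.suc i))

-- Monomials in the n² variables x_{ij}, i,j ∈ Fin n (Fin index i
-- stands for the row/column i+1 of the paper): exponent functions.

Mono : ℕ → Set
Mono n = Fin n → Fin n → ℕ

oneMono : ∀ {n} → Mono n
oneMono i j = 0

varMono : ∀ {n} → Fin n → Fin n → Mono n
varMono i j k l = if does (i Fin.≟ k) then (if does (j Fin.≟ l) then 1 else 0) else 0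

_⊗_ : ∀ {n} → Mono n → Mono n → Mono n
(m ⊗ m') i j = m i j ℕ.+ m' i j

prodMono : ∀ {n} (s : ℕ) → (Fin s → Mono n) → Mono n
prodMono zero    f = oneMono
prodMono (suc s) f = f Fin.zero ⊗ prodMono s (λ i → f (Fin.suc i))

_≐_ : ∀ {n} → Mono n → Mono n → Set
m ≐ m' = ∀ i j → m i j ≡ m' i j

_≐?_ : ∀ {n} (m m' : Mono n) → Dec (m ≐ m')
m ≐? m' = FinP.all? (λ i → FinP.all? (λ j → m i j ℕ.≟ m' i j))

deg : ∀ {n} → Mono n → ℕ
deg {n} m = sumFin n (λ i → sumFin n (λ j → m i j))

-- The variable order.  With 1-based indices i = toℕ i' + 1, j = toℕ j' + 1,
-- φ(i,j) = [((2-i)n + (j-1)(n-1) - 1) mod n²] + 1   (computed in ℤ).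

φ : (n : ℕ) → Fin n → Fin n → ℕ
φ (suc m) i' j' =
  let n = suc m
      i = + (suc (toℕ i'))
      j = + (suc (toℕ j'))
      N = + n
  in suc ((((+ 2 ℤ.- i) ℤ.* N ℤ.+ (j ℤ.- + 1) ℤ.* (N ℤ.- + 1)) ℤ.- + 1) %ℕ (n ℕ.* n))

_≺var_ : ∀ {n} → (Fin n × Fin n) → (Fin n × Fin n) → Set
_≺var_ {n} (i , j) (k , l) = φ n i j < φ n k l

-- Degree reverse lexicographic order: m ≺ m' iff deg m < deg m', or
-- deg m = deg m' and at the ⪯-smallest variable where the exponents
-- differ, m has the larger exponent.
_≺_ : ∀ {n} → Mono n → Mono n → Set
_≺_ {n} m m' =
  deg m < deg m' ⊎
  (deg m ≡ deg m' ×
   Σ (Fin n) λ i → Σ (Fin n) λ j →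
     m i j ≢ m' i j ×
     (∀ k l → (k , l) ≺var (i , j) → m k l ≡ m' k l) ×
     m' i j < m i j)

_⪯_ : ∀ {n} → Mono n → Mono n → Set
m ⪯ m' = m ≺ m' ⊎ m ≐ m'

-- Polynomials over a field K in the variables x_{ij}, represented as
-- formal finite sums of terms (coefficient, monomial).  Two
-- representations denote the same polynomial iff all coefficients agree
-- (`coeff` collects like terms).

module Poly {c ℓ} (K : Field c ℓ) where
  open Field K

  Pol : ℕ → Set c
  Pol n = List (Carrier × Mono n)

  coeff : ∀ {n} → Pol n → Mono n → Carrier
  coeff []             m = 0#
  coeff ((a , m') ∷ f) m = (if does (m' ≐? m) then a else 0#) + coeff f m

  constP : ∀ {n} → Carrier → Pol n
  constP a = (a , oneMono) ∷ []

  X : ∀ {n} → Fin n → Fin n → Pol n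
  X i j = (1# , varMono i j) ∷ []

  _+P_ : ∀ {n} → Pol n → Pol n → Pol n
  f +P g = f ++ g

  negP : ∀ {n} → Pol n → Pol n
  negP = map (λ { (a , m) → (- a , m) })

  _*P_ : ∀ {n} → Pol n → Pol n → Pol n
  f *P g = concatMap (λ { (a , m) → map (λ { (b , m') → (a * b , m ⊗ m') }) g }) f

  signP : ∀ {n} → ℕ → Pol n → Pol n
  signP zero    f = f
  signP (suc k) f = negP (signP k f)

  sumP : ∀ {n} (s : ℕ) → (Fin s → Pol n) → Pol n
  sumP zero    f = []
  sumP (suc s) f = f Fin.zero +P sumP s (λ i → f (Fin.suc i))

  det : ∀ {n} (s : ℕ) → (Fin s → Fin s → Pol n) → Pol n
  det zero    M = constP 1#
  det (suc s) M = sumP (suc s) λ j →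
    signP (toℕ j) (M Fin.zero j *P det s (λ r q → M (Fin.suc r) (Fin.punchIn j q)))

  IsLeadingMonomial : ∀ {n} → Pol n → Mono n → Set ℓ
  IsLeadingMonomial f m =
    ¬ (coeff f m ≈ 0#) × (∀ m' → ¬ (coeff f m' ≈ 0#) → m' ⪯ m)

-- Subsets A = {a_1 < … < a_s} ⊆ [n] are given by their increasing
-- enumeration a : Fin s → Fin n.

StrictlyIncreasing : ∀ {s n} → (Fin s → Fin n) → Set
StrictlyIncreasing a = ∀ i j → i Fin.< j → a i Fin.< a j

module _ {c ℓ} (K : Field c ℓ) where
  open Poly K
  subM : ∀ {s n} → (Fin s → Fin n) → (Fin s → Fin n) → Fin s → Fin s → Pol n
  subM a b r q = X (a r) (b q)

-- The condition "a_{i+ℓ} > b_i for all 1 ≤ i ≤ s-ℓ" (0-based indices)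
ShiftOK : ∀ {s n} → (Fin s → Fin n) → (Fin s → Fin n) → ℕ → Set
ShiftOK a b ℓ = ∀ i j → toℕ j ≡ toℕ i ℕ.+ ℓ → b i Fin.< a j

IsLeastShift : ∀ {s n} → (Fin s → Fin n) → (Fin s → Fin n) → ℕ → Set
IsLeastShift {s} a b ℓ = ℓ ≤ s × ShiftOK a b ℓ × (∀ ℓ' → ℓ' < ℓ → ¬ ShiftOK a b ℓ')

-- ∏_{(i,j) ∈ N(A,B)} x_{ij} = ∏_{i=1}^{s} x_{a_{(i+ℓ) mod s}, b_i};
-- in 0-based indices the row index of the i-th factor is (i+ℓ) mod s.
NMono : ∀ {k n} → (Fin (suc k) → Fin n) → (Fin (suc k) → Fin n) → ℕ → Mono n
NMono {k} a b ℓ = prodMono (suc k) λ i → varMono (a ((toℕ i ℕ.+ ℓ) mod suc k)) (b i)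

-- Laplace expansion shows that det M(A,B) is a sum of the permutation monomials
-- ∏_q x_{a(σ q), b(q)} for injective σ, and that each of them occurs with coefficient ±1.
-- These monomials all have degree s = k + 1 and exponents 0 or 1, and φ lists the
-- variables x_{ij} by decreasing cyclic gap (i - j - 1) mod n.  So the monomial of the
-- shift τ q = q + ℓ (mod s) is the leading one as soon as, for every σ and every p with
-- σ p ≠ τ p, some q with σ q ≠ τ q has a larger gap than the arc from b_p to a_{τ p}.
--
-- To see this, cut the circle ℤ/n at β = b_{i₀}, where by minimality of ℓ every row a_j
-- with j < i₀ + ℓ lies weakly below β (i₀ is where the shift ℓ - 1 fails).  After unrolling,
-- τ matches columns to rows in an order-preserving way, and its gaps become plain
-- differences of positions.  If no arc of σ away from τ were longer than the τ-arc at p,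
-- then starting from p the relation σ q = τ q' would always lead to a column lying
-- strictly before p.  But this walk follows the cycle of τ⁻¹σ through p, so it returns to p.

{-# OPTIONS --safe #-}
module Submission where

open import Defs
open import Data.Nat as ℕ using (ℕ; zero; suc; _<_; _≤_)
open import Data.Fin as Fin using (Fin; toℕ; punchIn; punchOut)
open import Data.Product using (_×_; _,_; ∃; ∃₂; proj₁; proj₂; uncurry)
open import Data.Sum using (_⊎_; inj₁; inj₂)
open import Data.List.Relation.Unary.All using (lookupAny)
open import Function using (_∘_; flip)
open import Function.Definitions using (Injective)
open import Relation.Nullary using (¬_; Dec; yes; no; does; contradiction)
open import Relation.Binary.PropositionalEquality
  using (_≡_; _≢_; refl; sym; trans; cong; cong₂; subst; subst₂; module ≡-Reasoning)

module Monomials where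

  open import Data.Nat using (_+_)
  open import Data.Nat.Properties as ℕP using (+-identityʳ)
  open import Data.Fin.Properties using (¬∀⟶∃¬; punchInᵢ≢i)
  open import Algebra.Properties.CommutativeMonoid.Sum ℕP.+-0-commutativeMonoid
    using (sum; sum-remove; ∑-distrib-+; sum-cong-≗; sum-replicate-zero)

  sumFin≡sum : ∀ s (f : Fin s → ℕ) → sumFin s f ≡ sum f
  sumFin≡sum zero    f = refl
  sumFin≡sum (suc s) f = cong (f Fin.zero +_) (sumFin≡sum s (f ∘ Fin.suc))

  sum-zero : ∀ {s} {f : Fin s → ℕ} → (∀ q → f q ≡ 0) → sum f ≡ 0
  sum-zero {s} f≡0 = trans (sum-cong-≗ f≡0) (sum-replicate-zero s)

  sum-single : ∀ {s} (f : Fin s → ℕ) q → (∀ r → r ≢ q → f r ≡ 0) → sum f ≡ f q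
  sum-single {suc s} f q others≡0 = begin
    sum f                                 ≡⟨ sum-remove f ⟩
    f q + sum (f ∘ punchIn q)             ≡⟨ cong (f q +_) (sum-zero (λ r → others≡0 _ (punchInᵢ≢i q r))) ⟩
    f q + 0                               ≡⟨ +-identityʳ (f q) ⟩
    f q                                   ∎
    where open ≡-Reasoning

  sum≢0⇒∃≢0 : ∀ {s} (f : Fin s → ℕ) → sum f ≢ 0 → ∃ λ q → f q ≢ 0
  sum≢0⇒∃≢0 f sum≢0 = ¬∀⟶∃¬ _ _ (λ q → f q ℕ.≟ 0) (sum≢0 ∘ sum-zero)

  module _ {n : ℕ} where

    ≐-sym : {m m' : Mono n} → m ≐ m' → m' ≐ m
    ≐-sym m≐m' i j = sym (m≐m' i j)

    ≐-trans : {m m' m'' : Mono n} → m ≐ m' → m' ≐ m'' → m ≐ m''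
    ≐-trans m≐m' m'≐m'' i j = trans (m≐m' i j) (m'≐m'' i j)

    ⊗-cong : {m₁ m₂ m₃ m₄ : Mono n} → m₁ ≐ m₂ → m₃ ≐ m₄ → (m₁ ⊗ m₃) ≐ (m₂ ⊗ m₄)
    ⊗-cong m₁≐m₂ m₃≐m₄ i j = cong₂ _+_ (m₁≐m₂ i j) (m₃≐m₄ i j)

    ⊗-cancelˡ : (v m m' : Mono n) → (v ⊗ m) ≐ (v ⊗ m') → m ≐ m'
    ⊗-cancelˡ v m m' eq i j = ℕP.+-cancelˡ-≡ (v i j) _ _ (eq i j)

    prodMono-apply : ∀ s (f : Fin s → Mono n) i j → prodMono s f i j ≡ sum (λ q → f q i j)
    prodMono-apply zero    f i j = refl
    prodMono-apply (suc s) f i j = cong (f Fin.zero i j +_) (prodMono-apply s (f ∘ Fin.suc) i j)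

    prodMono-cong : ∀ s {f g : Fin s → Mono n} → (∀ q → f q ≐ g q) → prodMono s f ≐ prodMono s g
    prodMono-cong zero    f≐g = λ _ _ → refl
    prodMono-cong (suc s) f≐g = ⊗-cong (f≐g Fin.zero) (prodMono-cong s (f≐g ∘ Fin.suc))

    prodMono-remove : ∀ s (f : Fin (suc s) → Mono n) q → prodMono (suc s) f ≐ (f q ⊗ prodMono s (f ∘ punchIn q))
    prodMono-remove s f q i j = begin
      prodMono (suc s) f i j                       ≡⟨ prodMono-apply (suc s) f i j ⟩
      sum (λ r → f r i j)                          ≡⟨ sum-remove (λ r → f r i j) ⟩
      f q i j + sum (λ r → f (punchIn q r) i j)    ≡⟨ cong (f q i j +_) (prodMono-apply s (f ∘ punchIn q) i j) ⟨
      f q i j + prodMono s (f ∘ punchIn q) i j     ∎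
      where open ≡-Reasoning

    varMono-diag : ∀ (i j : Fin n) → varMono i j i j ≡ 1
    varMono-diag i j with i Fin.≟ i | j Fin.≟ j
    ... | yes _  | yes _  = refl
    ... | no i≢i | _      = contradiction refl i≢i
    ... | yes _  | no j≢j = contradiction refl j≢j

    varMono-rowOff : ∀ {i k : Fin n} j l → i ≢ k → varMono i j k l ≡ 0
    varMono-rowOff {i} {k} j l i≢k with i Fin.≟ k
    ... | yes i≡k = contradiction i≡k i≢k
    ... | no _    = refl

    varMono-colOff : ∀ i k {j l : Fin n} → j ≢ l → varMono i j k l ≡ 0
    varMono-colOff i k {j} {l} j≢l with i Fin.≟ k | j Fin.≟ l
    ... | yes _ | yes j≡l = contradiction j≡l j≢l
    ... | yes _ | no _    = refl
    ... | no _  | _       = refl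

    varMono≢0 : ∀ (i j k l : Fin n) → varMono i j k l ≢ 0 → i ≡ k × j ≡ l
    varMono≢0 i j k l ≢0 with i Fin.≟ k | j Fin.≟ l
    ... | yes i≡k | yes j≡l = i≡k , j≡l
    ... | yes _   | no _    = contradiction refl ≢0
    ... | no _    | _       = contradiction refl ≢0

    deg≡∑∑ : (m : Mono n) → deg m ≡ sum (λ i → sum (λ j → m i j))
    deg≡∑∑ m = trans (sumFin≡sum n _) (sum-cong-≗ (λ i → sumFin≡sum n (m i)))

    deg-oneMono : deg (oneMono {n}) ≡ 0
    deg-oneMono = trans (deg≡∑∑ oneMono) (sum-zero {n} (λ i → sum-zero {n} (λ j → refl)))

    deg-⊗ : (m m' : Mono n) → deg (m ⊗ m') ≡ deg m + deg m'
    deg-⊗ m m' = begin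
      deg (m ⊗ m')                                          ≡⟨ deg≡∑∑ (m ⊗ m') ⟩
      sum (λ i → sum (λ j → m i j + m' i j))                ≡⟨ sum-cong-≗ (λ i → ∑-distrib-+ (m i) (m' i)) ⟩
      sum (λ i → sum (λ j → m i j) + sum (λ j → m' i j))    ≡⟨ ∑-distrib-+ (λ i → sum (m i)) (λ i → sum (m' i)) ⟩
      sum (λ i → sum (m i)) + sum (λ i → sum (m' i))        ≡⟨ cong₂ _+_ (deg≡∑∑ m) (deg≡∑∑ m') ⟨
      deg m + deg m'                                        ∎
      where open ≡-Reasoning

    deg-varMono : ∀ (i j : Fin n) → deg (varMono i j) ≡ 1
    deg-varMono i j = begin
      deg (varMono i j)                              ≡⟨ deg≡∑∑ (varMono i j) ⟩
      sum (λ k → sum (λ l → varMono i j k l))        ≡⟨ sum-single _ i other-rows ⟩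
      sum (λ l → varMono i j i l)                    ≡⟨ sum-single _ j (λ l l≢j → varMono-colOff i i (l≢j ∘ sym)) ⟩
      varMono i j i j                                ≡⟨ varMono-diag i j ⟩
      1                                              ∎
      where
      open ≡-Reasoning
      other-rows : ∀ k → k ≢ i → sum (λ l → varMono i j k l) ≡ 0
      other-rows k k≢i = sum-zero {n} (λ l → varMono-rowOff j l (k≢i ∘ sym))

    deg-prodMono : ∀ s (f : Fin s → Mono n) → (∀ q → deg (f q) ≡ 1) → deg (prodMono s f) ≡ s
    deg-prodMono zero    f _      = deg-oneMono
    deg-prodMono (suc s) f deg≡1 = begin
      deg (f Fin.zero ⊗ prodMono s (f ∘ Fin.suc))          ≡⟨ deg-⊗ (f Fin.zero) _ ⟩
      deg (f Fin.zero) + deg (prodMono s (f ∘ Fin.suc))    ≡⟨ cong₂ _+_ (deg≡1 Fin.zero) deg-rest ⟩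
      suc s                                                ∎
      where
      open ≡-Reasoning
      deg-rest : deg (prodMono s (f ∘ Fin.suc)) ≡ s
      deg-rest = deg-prodMono s (f ∘ Fin.suc) (deg≡1 ∘ Fin.suc)

    deg-resp-≐ : {m m' : Mono n} → m ≐ m' → deg m ≡ deg m'
    deg-resp-≐ {m} {m'} m≐m' =
      trans (deg≡∑∑ m) (trans (sum-cong-≗ (λ i → sum-cong-≗ (m≐m' i))) (sym (deg≡∑∑ m')))

    permMono : ∀ {s} (a b : Fin s → Fin n) → (Fin s → Fin s) → Mono n
    permMono {s} a b σ = prodMono s (λ q → varMono (a (σ q)) (b q))

    deg-permMono : ∀ {s} (a b : Fin s → Fin n) σ → deg (permMono a b σ) ≡ s
    deg-permMono {s} a b σ = deg-prodMono s _ (λ q → deg-varMono (a (σ q)) (b q))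

    permMono-support : ∀ {s} (a b : Fin s → Fin n) σ i j → permMono a b σ i j ≢ 0 →
                       ∃ λ q → a (σ q) ≡ i × b q ≡ j
    permMono-support {s} a b σ i j ≢0 =
      let q , q≢0 = sum≢0⇒∃≢0 _ (≢0 ∘ trans (prodMono-apply s _ i j)) in q , varMono≢0 _ _ i j q≢0

    permMono-split : ∀ {s} (a b : Fin (suc s) → Fin n) (σ : Fin (suc s) → Fin (suc s)) {σ' : Fin s → Fin s} j →
                     (∀ q → σ (punchIn j q) ≡ Fin.suc (σ' q)) →
                     permMono a b σ ≐ (varMono (a (σ j)) (b j) ⊗ permMono (a ∘ Fin.suc) (b ∘ punchIn j) σ')
    permMono-split {s} a b σ j σ∘punchIn =
      ≐-trans (prodMono-remove s (λ q → varMono (a (σ q)) (b q)) j)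
              (⊗-cong (λ _ _ → refl) (prodMono-cong s λ q k l → cong (λ r → varMono (a r) (b (punchIn j q)) k l) (σ∘punchIn q)))

    module _ {s} (a b : Fin s → Fin n) (b-inj : Injective _≡_ _≡_ b) (σ : Fin s → Fin s) where

      permMono-column : ∀ q i → permMono a b σ i (b q) ≡ varMono (a (σ q)) (b q) i (b q)
      permMono-column q i =
        trans (prodMono-apply s _ i (b q)) (sum-single _ q (λ r r≢q → varMono-colOff (a (σ r)) i (r≢q ∘ b-inj)))

      permMono-on : ∀ q → permMono a b σ (a (σ q)) (b q) ≡ 1
      permMono-on q = trans (permMono-column q (a (σ q))) (varMono-diag (a (σ q)) (b q))

      permMono-off : Injective _≡_ _≡_ a → ∀ q r → σ q ≢ r → permMono a b σ (a r) (b q) ≡ 0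
      permMono-off a-inj q r σq≢r = trans (permMono-column q (a r)) (varMono-rowOff (b q) (b q) (σq≢r ∘ a-inj))

open Monomials

module Permutations where

  open import Data.Nat using (_+_)
  open import Data.Nat.Properties as ℕP using (≤-refl; <⇒≤; <-irrefl; +-identityʳ; +-suc; m≤n⇒∃[o]m+o≡n)
  open import Data.Fin.Properties
    using (punchInᵢ≢i; punchIn-injective; punchOut-injective; punchIn-punchOut; punchOut-punchIn; punchOut-cong; suc-injective;
           any?; injective⇒≤; pigeonhole)
  open import Data.Empty using (⊥)

  injective⇒surjective : ∀ {m} (f : Fin m → Fin m) → Injective _≡_ _≡_ f → ∀ y → ∃ λ x → f x ≡ y
  injective⇒surjective {suc m} f f-inj y with any? (λ x → f x Fin.≟ y)
  ... | yes hit = hit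
  ... | no miss = contradiction (injective⇒≤ g-inj) ℕP.1+n≰n
    where
    fx≢y : ∀ x → y ≢ f x
    fx≢y x = miss ∘ (x ,_) ∘ sym
    g : Fin (suc m) → Fin m
    g x = punchOut (fx≢y x)
    g-inj : Injective _≡_ _≡_ g
    g-inj = f-inj ∘ punchOut-injective (fx≢y _) (fx≢y _)

  module _ {s : ℕ} where

    insertZero : Fin (suc s) → (Fin s → Fin s) → Fin (suc s) → Fin (suc s)
    insertZero j σ x with j Fin.≟ x
    ... | yes _   = Fin.zero
    ... | no j≢x  = Fin.suc (σ (punchOut j≢x))

    insertZero-pivot : ∀ j σ → insertZero j σ j ≡ Fin.zero
    insertZero-pivot j σ with j Fin.≟ j
    ... | yes _  = refl
    ... | no j≢j = contradiction refl j≢j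

    insertZero-punchIn : ∀ j σ q → insertZero j σ (punchIn j q) ≡ Fin.suc (σ q)
    insertZero-punchIn j σ q with j Fin.≟ punchIn j q
    ... | yes j≡ = contradiction (sym j≡) (punchInᵢ≢i j q)
    ... | no j≢  = cong (Fin.suc ∘ σ) (trans (punchOut-cong j refl) (punchOut-punchIn j))

    insertZero-injective : ∀ j {σ} → Injective _≡_ _≡_ σ → Injective _≡_ _≡_ (insertZero j σ)
    insertZero-injective j σ-inj {x} {y} eq with j Fin.≟ x | j Fin.≟ y
    ... | yes j≡x | yes j≡y = trans (sym j≡x) j≡y
    ... | no j≢x  | no j≢y  = punchOut-injective j≢x j≢y (σ-inj (suc-injective eq))
    ... | yes _   | no _    with () ← eq
    ... | no _    | yes _   with () ← eq

    module Removal {σ : Fin (suc s) → Fin (suc s)} (σ-inj : Injective _≡_ _≡_ σ) (j : Fin (suc s)) where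

      private
        σj≢ : ∀ q → σ j ≢ σ (punchIn j q)
        σj≢ q = punchInᵢ≢i j q ∘ sym ∘ σ-inj

      removed : Fin s → Fin s
      removed q = punchOut (σj≢ q)

      punchIn-removed : ∀ q → σ (punchIn j q) ≡ punchIn (σ j) (removed q)
      punchIn-removed q = sym (punchIn-punchOut (σj≢ q))

      removed-injective : Injective _≡_ _≡_ removed
      removed-injective = punchIn-injective j _ _ ∘ σ-inj ∘ punchOut-injective (σj≢ _) (σj≢ _)

  module _ {m : ℕ} {σ τ : Fin m → Fin m} (σ-inj : Injective _≡_ _≡_ σ) (κ : Fin m → ℕ) (p : Fin m)
           (descend : ∀ q → κ q ≤ κ p → ∃ λ q' → κ q' < κ p × σ q ≡ τ q') where

    private
      orbit : ℕ → ∃ λ q → κ q ≤ κ p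
      orbit zero    = p , ≤-refl
      orbit (suc t) = let q' , below , _ = descend (proj₁ (orbit t)) (proj₂ (orbit t)) in q' , <⇒≤ below

      F : ℕ → Fin m
      F = proj₁ ∘ orbit

      F-link : ∀ t → σ (F t) ≡ τ (F (suc t))
      F-link t = proj₂ (proj₂ (descend (proj₁ (orbit t)) (proj₂ (orbit t))))

      F-below : ∀ t → κ (F (suc t)) < κ p
      F-below t = proj₁ (proj₂ (descend (proj₁ (orbit t)) (proj₂ (orbit t))))

      F-cancel : ∀ c t u → F (c + t) ≡ F (c + u) → F t ≡ F u
      F-cancel zero    t u eq = eq
      F-cancel (suc c) t u eq = F-cancel c t u (σ-inj (trans (F-link (c + t)) (trans (cong τ eq) (sym (F-link (c + u))))))

    -- The walk p = q₀, σ qₜ = τ qₜ₊₁ follows the cycle of τ⁻¹σ through p, so it returns to p;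
    -- yet κ qₜ₊₁ < κ p for every t.
    no-descent : ⊥
    no-descent with pigeonhole ≤-refl (F ∘ toℕ {suc m})
    ... | i , j , i<j , Fi≡Fj with m≤n⇒∃[o]m+o≡n i<j
    ...   | d , 1+i+d≡j = <-irrefl (cong κ (sym p≡F[1+d])) (F-below d)
      where
      p≡F[1+d] : p ≡ F (suc d)
      p≡F[1+d] = F-cancel (toℕ i) 0 (suc d) (begin
        F (toℕ i + 0)        ≡⟨ cong F (+-identityʳ (toℕ i)) ⟩
        F (toℕ i)            ≡⟨ Fi≡Fj ⟩
        F (toℕ j)            ≡⟨ cong F (trans (sym 1+i+d≡j) (sym (+-suc (toℕ i) d))) ⟩
        F (toℕ i + suc d)    ∎)
        where open ≡-Reasoning

  IsPermMono : ∀ {n s} (a b : Fin s → Fin n) → Mono n → Set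
  IsPermMono a b m = ∃ λ σ → Injective _≡_ _≡_ σ × m ≐ permMono a b σ

  IsPermMono-extend : ∀ {n s} (a b : Fin (suc s) → Fin n) j m →
                      IsPermMono (a ∘ Fin.suc) (b ∘ punchIn j) m → IsPermMono a b (varMono (a Fin.zero) (b j) ⊗ m)
  IsPermMono-extend a b j m (σ , σ-inj , m≐σ) =
    insertZero j σ , insertZero-injective j σ-inj ,
    ≐-sym (≐-trans (permMono-split a b (insertZero j σ) j (insertZero-punchIn j σ))
                   (⊗-cong (λ k l → cong (λ r → varMono (a r) (b j) k l) (insertZero-pivot j σ)) (≐-sym m≐σ)))

open Permutations

module Determinant {c ℓ} (K : Field c ℓ) where

  open import Data.Bool using (true; false; if_then_else_)
  open import Data.List using ([]; _∷_; _++_)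
  open import Data.List.Relation.Unary.All as All using (All; []; _∷_)
  open import Data.List.Relation.Unary.All.Properties using (++⁺; map⁺)
  open import Data.List.Relation.Unary.Any using (Any; here; there)
  open import Data.Fin.Properties using (suc-injective; punchIn-injective)
  open import Function.Bundles using (_⇔_; mk⇔)
  open import Relation.Nullary.Decidable using (dec-true; dec-false; does-⇔)

  open Field K hiding (zero) renaming (refl to ≈-refl; sym to ≈-sym; trans to ≈-trans)
  open Poly K
  open import Algebra.Properties.Ring ring using (-0#≈0#; -‿involutive; -‿+-comm)
  open import Relation.Binary.Reasoning.Setoid setoid

  Supported : ∀ {n} → (Mono n → Set) → Pol n → Set c
  Supported P = All (P ∘ proj₂)

  IsSign : Carrier → Set ℓ
  IsSign x = x ≈ 1# ⊎ x ≈ - 1#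

  IsSign-≉0 : ∀ {x} → IsSign x → ¬ x ≈ 0#
  IsSign-≉0 (inj₁ x≈1)  x≈0 = 1≉0 (≈-trans (≈-sym x≈1) x≈0)
  IsSign-≉0 (inj₂ x≈-1) x≈0 = 1≉0 (begin
    1#         ≈⟨ -‿involutive 1# ⟨
    - (- 1#)   ≈⟨ -‿cong (≈-trans (≈-sym x≈-1) x≈0) ⟩
    - 0#       ≈⟨ -0#≈0# ⟩
    0#         ∎)

  coeff-∷-≐ : ∀ {n} a t (f : Pol n) {m} → t ≐ m → coeff ((a , t) ∷ f) m ≈ a + coeff f m
  coeff-∷-≐ a t f {m} t≐m = reflexive (cong (λ d → (if d then a else 0#) + coeff f m) (dec-true (t ≐? m) t≐m))

  coeff-∷-≭ : ∀ {n} a t (f : Pol n) {m} → ¬ t ≐ m → coeff ((a , t) ∷ f) m ≈ coeff f m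
  coeff-∷-≭ a t f {m} t≭m =
    ≈-trans (reflexive (cong (λ d → (if d then a else 0#) + coeff f m) (dec-false (t ≐? m) t≭m))) (+-identityˡ _)

  coeff-resp-≐ : ∀ {n} (f : Pol n) {m m'} → m ≐ m' → coeff f m ≡ coeff f m'
  coeff-resp-≐ []            _ = refl
  coeff-resp-≐ ((a , t) ∷ f) {m} {m'} m≐m' =
    cong₂ (λ d r → (if d then a else 0#) + r) (does-⇔ t≐m⇔t≐m' (t ≐? m) (t ≐? m')) (coeff-resp-≐ f m≐m')
    where
    t≐m⇔t≐m' : t ≐ m ⇔ t ≐ m'
    t≐m⇔t≐m' = mk⇔ (λ t≐m → ≐-trans t≐m m≐m') (λ t≐m' → ≐-trans t≐m' (≐-sym m≐m'))

  coeff≉0⇒occurs : ∀ {n} (f : Pol n) m → ¬ coeff f m ≈ 0# → Any ((_≐ m) ∘ proj₂) f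
  coeff≉0⇒occurs []            m ≉0 = contradiction ≈-refl ≉0
  coeff≉0⇒occurs ((a , t) ∷ f) m ≉0 with t ≐? m
  ... | yes t≐m = here t≐m
  ... | no t≭m  = there (coeff≉0⇒occurs f m (≉0 ∘ ≈-trans (coeff-∷-≭ a t f t≭m)))

  coeff-++ : ∀ {n} (f g : Pol n) m → coeff (f ++ g) m ≈ coeff f m + coeff g m
  coeff-++ []            g m = ≈-sym (+-identityˡ _)
  coeff-++ ((a , t) ∷ f) g m = ≈-trans (+-congˡ (coeff-++ f g m)) (≈-sym (+-assoc _ _ _))

  coeff-negP : ∀ {n} (f : Pol n) m → coeff (negP f) m ≈ - coeff f m
  coeff-negP []            m = ≈-sym -0#≈0#
  coeff-negP ((a , t) ∷ f) m =
    ≈-trans (+-cong (if-neg (does (t ≐? m))) (coeff-negP f m)) (-‿+-comm _ _)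
    where
    if-neg : ∀ d → (if d then - a else 0#) ≈ - (if d then a else 0#)
    if-neg true  = ≈-refl
    if-neg false = ≈-sym -0#≈0#

  coeff-signP-zero : ∀ {n} k (f : Pol n) m → coeff f m ≈ 0# → coeff (signP k f) m ≈ 0#
  coeff-signP-zero zero    f m ≈0 = ≈0
  coeff-signP-zero (suc k) f m ≈0 =
    ≈-trans (coeff-negP (signP k f) m) (≈-trans (-‿cong (coeff-signP-zero k f m ≈0)) -0#≈0#)

  coeff-signP-sign : ∀ {n} k (f : Pol n) m → IsSign (coeff f m) → IsSign (coeff (signP k f) m)
  coeff-signP-sign zero    f m sign = sign
  coeff-signP-sign (suc k) f m sign with coeff-signP-sign k f m sign
  ... | inj₁ ≈1  = inj₂ (≈-trans (coeff-negP (signP k f) m) (-‿cong ≈1))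
  ... | inj₂ ≈-1 = inj₁ (≈-trans (coeff-negP (signP k f) m) (≈-trans (-‿cong ≈-1) (-‿involutive 1#)))

  coeff-X*P : ∀ {n} (i j : Fin n) (g : Pol n) m → coeff (X i j *P g) (varMono i j ⊗ m) ≈ coeff g m
  coeff-X*P i j []            m = ≈-refl
  coeff-X*P i j ((a , t) ∷ g) m with t ≐? m
  ... | yes t≐m = ≈-trans (coeff-∷-≐ (1# * a) _ (X i j *P g) (⊗-cong (λ _ _ → refl) t≐m))
                          (≈-trans (+-cong (*-identityˡ a) (coeff-X*P i j g m)) (≈-sym (coeff-∷-≐ a t g t≐m)))
  ... | no t≭m  = ≈-trans (coeff-∷-≭ (1# * a) _ (X i j *P g) (t≭m ∘ ⊗-cancelˡ (varMono i j) t m))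
                          (≈-trans (coeff-X*P i j g m) (≈-sym (coeff-∷-≭ a t g t≭m)))

  coeff-X*P-absent : ∀ {n} (i j : Fin n) (g : Pol n) m → m i j ≡ 0 → coeff (X i j *P g) m ≈ 0#
  coeff-X*P-absent i j []            m _   = ≈-refl
  coeff-X*P-absent i j ((a , t) ∷ g) m ≡0 =
    ≈-trans (coeff-∷-≭ (1# * a) _ (X i j *P g) vt≭m) (coeff-X*P-absent i j g m ≡0)
    where
    vt≭m : ¬ (varMono i j ⊗ t) ≐ m
    vt≭m vt≐m = subst (λ e → e ℕ.+ t i j ≢ 0) (sym (varMono-diag i j)) (λ ()) (trans (vt≐m i j) ≡0)

  coeff-sumP : ∀ {n} s (F : Fin (suc s) → Pol n) m →
               coeff (sumP (suc s) F) m ≈ coeff (F Fin.zero) m + coeff (sumP s (F ∘ Fin.suc)) m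
  coeff-sumP s F m = coeff-++ (F Fin.zero) (sumP s (F ∘ Fin.suc)) m

  coeff-sumP-zero : ∀ {n} s (F : Fin s → Pol n) m → (∀ j → coeff (F j) m ≈ 0#) → coeff (sumP s F) m ≈ 0#
  coeff-sumP-zero zero    F m _  = ≈-refl
  coeff-sumP-zero (suc s) F m ≈0 = begin
    coeff (sumP (suc s) F) m                                ≈⟨ coeff-sumP s F m ⟩
    coeff (F Fin.zero) m + coeff (sumP s (F ∘ Fin.suc)) m   ≈⟨ +-cong (≈0 Fin.zero) (coeff-sumP-zero s _ m (≈0 ∘ Fin.suc)) ⟩
    0# + 0#                                                 ≈⟨ +-identityˡ 0# ⟩
    0#                                                      ∎

  coeff-sumP-single : ∀ {n} s (F : Fin s → Pol n) m j → (∀ j' → j' ≢ j → coeff (F j') m ≈ 0#) →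
                      coeff (sumP s F) m ≈ coeff (F j) m
  coeff-sumP-single (suc s) F m Fin.zero others≈0 = begin
    coeff (sumP (suc s) F) m                                ≈⟨ coeff-sumP s F m ⟩
    coeff (F Fin.zero) m + coeff (sumP s (F ∘ Fin.suc)) m   ≈⟨ +-congˡ (coeff-sumP-zero s (F ∘ Fin.suc) m tail≈0) ⟩
    coeff (F Fin.zero) m + 0#                               ≈⟨ +-identityʳ _ ⟩
    coeff (F Fin.zero) m                                    ∎
    where
    tail≈0 : ∀ j → coeff (F (Fin.suc j)) m ≈ 0#
    tail≈0 j = others≈0 (Fin.suc j) λ ()
  coeff-sumP-single (suc s) F m (Fin.suc j) others≈0 = begin
    coeff (sumP (suc s) F) m                                ≈⟨ coeff-sumP s F m ⟩
    coeff (F Fin.zero) m + coeff (sumP s (F ∘ Fin.suc)) m   ≈⟨ +-cong (others≈0 Fin.zero λ ()) tail≈ ⟩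
    0# + coeff (F (Fin.suc j)) m                            ≈⟨ +-identityˡ _ ⟩
    coeff (F (Fin.suc j)) m                                 ∎
    where
    tail≈ : coeff (sumP s (F ∘ Fin.suc)) m ≈ coeff (F (Fin.suc j)) m
    tail≈ = coeff-sumP-single s (F ∘ Fin.suc) m j (λ j' j'≢j → others≈0 (Fin.suc j') (j'≢j ∘ suc-injective))

  IsSign-resp : ∀ {x y} → x ≈ y → IsSign y → IsSign x
  IsSign-resp x≈y (inj₁ y≈1)  = inj₁ (≈-trans x≈y y≈1)
  IsSign-resp x≈y (inj₂ y≈-1) = inj₂ (≈-trans x≈y y≈-1)

  Supported-sumP : ∀ {n} {P : Mono n → Set} s (F : Fin s → Pol n) → (∀ j → Supported P (F j)) → Supported P (sumP s F)
  Supported-sumP zero    F _    = []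
  Supported-sumP (suc s) F supp = ++⁺ (supp Fin.zero) (Supported-sumP s (F ∘ Fin.suc) (supp ∘ Fin.suc))

  Supported-signP : ∀ {n} {P : Mono n → Set} k (f : Pol n) → Supported P f → Supported P (signP k f)
  Supported-signP zero    f supp = supp
  Supported-signP (suc k) f supp = map⁺ (Supported-signP k f supp)

  Supported-X*P : ∀ {n} {P Q : Mono n → Set} i j (g : Pol n) → (∀ m → P m → Q (varMono i j ⊗ m)) →
                  Supported P g → Supported Q (X i j *P g)
  Supported-X*P i j g P⇒Q supp = ++⁺ (map⁺ (All.map (P⇒Q _) supp)) []

  det-support : ∀ {n} s (a b : Fin s → Fin n) → Supported (IsPermMono a b) (det s (subM K a b))
  det-support zero    a b = ((λ ()) , (λ { {()} }) , (λ _ _ → refl)) ∷ []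
  det-support (suc s) a b = Supported-sumP (suc s) _ λ j →
    Supported-signP (toℕ j) _ (Supported-X*P (a Fin.zero) (b j) _ (IsPermMono-extend a b j)
      (det-support s (a ∘ Fin.suc) (b ∘ punchIn j)))

  coeff-det-permMono : ∀ {n} s (a b : Fin s → Fin n) → Injective _≡_ _≡_ a → Injective _≡_ _≡_ b →
                       ∀ σ → Injective _≡_ _≡_ σ → IsSign (coeff (det s (subM K a b)) (permMono a b σ))
  coeff-det-permMono {n} zero a b _ _ σ _ =
    inj₁ (≈-trans (coeff-∷-≐ 1# oneMono [] {oneMono {n}} (λ _ _ → refl)) (+-identityʳ 1#))
  coeff-det-permMono {n} (suc s) a b a-inj b-inj σ σ-inj =
    IsSign-resp (coeff-sumP-single (suc s) expansion m j others≈0)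
      (coeff-signP-sign (toℕ j) _ m (IsSign-resp (reflexive (coeff-resp-≐ (X (a Fin.zero) (b j) *P minor j) m≐)) pivot))
    where
    j : Fin (suc s)
    j = proj₁ (injective⇒surjective σ σ-inj Fin.zero)
    σj≡0 : σ j ≡ Fin.zero
    σj≡0 = proj₂ (injective⇒surjective σ σ-inj Fin.zero)
    open Removal σ-inj j
    minor : Fin (suc s) → Pol n
    minor j' = det s (subM K (a ∘ Fin.suc) (b ∘ punchIn j'))
    expansion : Fin (suc s) → Pol n
    expansion j' = signP (toℕ j') (X (a Fin.zero) (b j') *P minor j')
    m m' : Mono n
    m = permMono a b σ
    m' = permMono (a ∘ Fin.suc) (b ∘ punchIn j) removed
    m≐ : m ≐ (varMono (a Fin.zero) (b j) ⊗ m')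
    m≐ = subst (λ r → m ≐ (varMono (a r) (b j) ⊗ m'))
               σj≡0 (permMono-split a b σ j (λ q → trans (punchIn-removed q) (cong (λ r → punchIn r (removed q)) σj≡0)))
    pivot : IsSign (coeff (X (a Fin.zero) (b j) *P minor j) (varMono (a Fin.zero) (b j) ⊗ m'))
    pivot = IsSign-resp (coeff-X*P (a Fin.zero) (b j) (minor j) m')
      (coeff-det-permMono s (a ∘ Fin.suc) (b ∘ punchIn j) (suc-injective ∘ a-inj) (punchIn-injective j _ _ ∘ b-inj)
                          removed removed-injective)
    others≈0 : ∀ j' → j' ≢ j → coeff (expansion j') m ≈ 0#
    others≈0 j' j'≢j = coeff-signP-zero (toℕ j') _ m (coeff-X*P-absent (a Fin.zero) (b j') (minor j') m
      (permMono-off a b b-inj σ a-inj j' Fin.zero (j'≢j ∘ σ-inj ∘ λ σj'≡0 → trans σj'≡0 (sym σj≡0))))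

module VariableOrder where

  open import Data.Nat using (_+_; _*_; _∸_; _<?_; s≤s; z≤n; NonZero)
  open import Data.Nat.Properties
  open import Data.Nat.DivMod using (_%_; m<n⇒m%n≡m)
  open import Data.Integer as ℤ using (ℤ; +_; -[1+_]; _%ℕ_)
  import Data.Integer.Properties as ℤP
  open import Data.Integer.Tactic.RingSolver using (solve-∀)
  open import Data.Fin.Properties using (toℕ<n)

  -- For x, y < n this is (x - y - 1) mod n: the length of the arc from column y forward
  -- to row x around ℤ/n, minus one.
  cyclicGap : ℕ → ℕ → ℕ → ℕ
  cyclicGap n x y with y <? x
  ... | yes _ = x ∸ suc y
  ... | no _  = n + x ∸ suc y

  cyclicGap-< : ∀ n {x y} → y < x → cyclicGap n x y + suc y ≡ x
  cyclicGap-< n {x} {y} y<x with y <? x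
  ... | yes _   = m∸n+n≡m y<x
  ... | no y≮x  = contradiction y<x y≮x

  cyclicGap-≥ : ∀ {n x y} → x ≤ y → y < n → cyclicGap n x y + suc y ≡ n + x
  cyclicGap-≥ {n} {x} {y} x≤y y<n with y <? x
  ... | yes y<x = contradiction x≤y (<⇒≱ y<x)
  ... | no _    = m∸n+n≡m (≤-trans y<n (m≤m+n n x))

  cyclicGap-cases : ∀ {n x y} → y < n → cyclicGap n x y + suc y ≡ x ⊎ cyclicGap n x y + suc y ≡ n + x
  cyclicGap-cases {n} {x} {y} y<n = cases (y <? x)
    where
    cases : Dec (y < x) → cyclicGap n x y + suc y ≡ x ⊎ cyclicGap n x y + suc y ≡ n + x
    cases (yes y<x) = inj₁ (cyclicGap-< n y<x)
    cases (no y≮x)  = inj₂ (cyclicGap-≥ (≮⇒≥ y≮x) y<n)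

  cyclicGap<n : ∀ {n x y} → x < n → y < n → cyclicGap n x y < n
  cyclicGap<n {n} {x} {y} x<n y<n = +-cancelʳ-< (suc y) _ n (bound (y <? x))
    where
    open ≤-Reasoning
    bound : Dec (y < x) → cyclicGap n x y + suc y < n + suc y
    bound (yes y<x) = begin-strict
      cyclicGap n x y + suc y   ≡⟨ cyclicGap-< n y<x ⟩
      x                         <⟨ x<n ⟩
      n                         ≤⟨ m≤m+n n (suc y) ⟩
      n + suc y                 ∎
    bound (no y≮x) = begin-strict
      cyclicGap n x y + suc y   ≡⟨ cyclicGap-≥ (≮⇒≥ y≮x) y<n ⟩
      n + x                     ≤⟨ +-monoʳ-≤ n (≮⇒≥ y≮x) ⟩
      n + y                     <⟨ +-monoʳ-< n (n<1+n y) ⟩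
      n + suc y                 ∎

  varRank : ℕ → ℕ → ℕ → ℕ
  varRank n x y = cyclicGap n x y * n + y

  varRank< : ∀ {n x y} → x < n → y < n → varRank n x y < n * n
  varRank< {n} {x} {y} x<n y<n = begin-strict
    cyclicGap n x y * n + y   <⟨ +-monoʳ-< (cyclicGap n x y * n) y<n ⟩
    cyclicGap n x y * n + n   ≡⟨ +-comm _ n ⟩
    suc (cyclicGap n x y) * n ≤⟨ *-monoˡ-≤ n (cyclicGap<n x<n y<n) ⟩
    n * n                     ∎
    where open ≤-Reasoning

  varRank-mono : ∀ {n x y x' y'} → y < n → cyclicGap n x y < cyclicGap n x' y' → varRank n x y < varRank n x' y'
  varRank-mono {n} {x} {y} {x'} {y'} y<n gap<gap' = begin-strict
    cyclicGap n x y * n + y   <⟨ +-monoʳ-< (cyclicGap n x y * n) y<n ⟩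
    cyclicGap n x y * n + n   ≡⟨ +-comm _ n ⟩
    suc (cyclicGap n x y) * n ≤⟨ *-monoˡ-≤ n gap<gap' ⟩
    cyclicGap n x' y' * n     ≤⟨ m≤m+n _ y' ⟩
    varRank n x' y'           ∎
    where open ≤-Reasoning

  suc-varRank< : ∀ {n x y} → y < x → x < n → suc (varRank n x y) < n * n
  suc-varRank< {n} {x} {y} y<x x<n = begin-strict
    suc (g * n + y)       ≡⟨ +-suc (g * n) y ⟨
    g * n + suc y         ≤⟨ +-monoʳ-≤ (g * n) (m≤n+m (suc y) g) ⟩
    g * n + (g + suc y)   ≡⟨ cong (λ z → g * n + z) (cyclicGap-< n y<x) ⟩
    g * n + x             <⟨ +-monoʳ-< (g * n) x<n ⟩
    g * n + n             ≡⟨ +-comm (g * n) n ⟩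
    suc g * n             ≤⟨ *-monoˡ-≤ n (cyclicGap<n x<n (<-trans y<x x<n)) ⟩
    n * n                 ∎
    where
    g = cyclicGap n x y
    open ≤-Reasoning

  -- φ (suc m) i j is definitionally suc (φ-numerator n x y %ℕ (n * n)) with x = toℕ i, y = toℕ j;
  -- the numerator equals (1 + y - x) n - y - 1, that is + (n² ∸ suc (varRank n x y)) if x ≤ y
  -- and -[1+ varRank n x y ] if y < x.
  φ-numerator : ℕ → ℕ → ℕ → ℤ
  φ-numerator n x y = ((+ 2 ℤ.- + suc x) ℤ.* + n ℤ.+ (+ suc y ℤ.- + 1) ℤ.* (+ n ℤ.- + 1)) ℤ.- + 1

  φ-numerator-identity : ∀ n x y g → φ-numerator n x y ℤ.+ + suc (g * n + y) ≡ + n ℤ.* (+ (g + suc y) ℤ.- + x)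
  φ-numerator-identity n x y g = trans (cong (λ z → φ-numerator n x y ℤ.+ (+ 1 ℤ.+ (z ℤ.+ + y))) (ℤP.pos-* g n))
                                       (identity (+ x) (+ y) (+ g) (+ n))
    where
    identity : ∀ X Y G N →
               (((+ 2 ℤ.- (+ 1 ℤ.+ X)) ℤ.* N ℤ.+ ((+ 1 ℤ.+ Y) ℤ.- + 1) ℤ.* (N ℤ.- + 1)) ℤ.- + 1) ℤ.+ (+ 1 ℤ.+ (G ℤ.* N ℤ.+ Y))
               ≡ N ℤ.* ((G ℤ.+ (+ 1 ℤ.+ Y)) ℤ.- X)
    identity = solve-∀

  -[1+]%ℕ : ∀ t d .{{_ : NonZero d}} → suc t < d → -[1+ t ] %ℕ d ≡ d ∸ suc t
  -[1+]%ℕ t d@(suc _) t<d with suc t % d | m<n⇒m%n≡m t<d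
  ... | .(suc t) | refl = refl

  module _ {n x y : ℕ} where

    private
      g t : ℕ
      g = cyclicGap n x y
      t = varRank n x y
      E : ℤ
      E = φ-numerator n x y

      N[z-x]-1-t : ℕ → ℤ
      N[z-x]-1-t z = + n ℤ.* (+ z ℤ.- + x) ℤ.- + suc t

      add-sub : ∀ A B → A ≡ (A ℤ.+ B) ℤ.- B
      add-sub = solve-∀

    φ-numerator-unwrapped : y < x → E ≡ -[1+ t ]
    φ-numerator-unwrapped y<x = begin
      E                                                ≡⟨ add-sub E (+ suc t) ⟩
      (E ℤ.+ + suc t) ℤ.- + suc t                      ≡⟨ cong (ℤ._- + suc t) (φ-numerator-identity n x y g) ⟩
      + n ℤ.* (+ (g + suc y) ℤ.- + x) ℤ.- + suc t      ≡⟨ cong (λ z → N[z-x]-1-t z) (cyclicGap-< n y<x) ⟩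
      + n ℤ.* (+ x ℤ.- + x) ℤ.- + suc t                ≡⟨ annihilate (+ n) (+ x) (+ suc t) ⟩
      -[1+ t ]                                         ∎
      where
      open ≡-Reasoning
      annihilate : ∀ A B C → A ℤ.* (B ℤ.- B) ℤ.- C ≡ ℤ.- C
      annihilate = solve-∀

    φ-numerator-wrapped : x ≤ y → y < n → x < n → E ≡ + (n * n ∸ suc t)
    φ-numerator-wrapped x≤y y<n x<n = begin
      E                                                ≡⟨ add-sub E (+ suc t) ⟩
      (E ℤ.+ + suc t) ℤ.- + suc t                      ≡⟨ cong (ℤ._- + suc t) (φ-numerator-identity n x y g) ⟩
      + n ℤ.* (+ (g + suc y) ℤ.- + x) ℤ.- + suc t      ≡⟨ cong (λ z → N[z-x]-1-t z) (cyclicGap-≥ x≤y y<n) ⟩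
      + n ℤ.* ((+ n ℤ.+ + x) ℤ.- + x) ℤ.- + suc t      ≡⟨ cancel (+ n) (+ x) (+ suc t) ⟩
      + n ℤ.* + n ℤ.- + suc t                          ≡⟨ cong (ℤ._- + suc t) (ℤP.pos-* n n) ⟨
      + (n * n) ℤ.- + suc t                            ≡⟨ ℤP.[+m]-[+n]≡m⊖n (n * n) (suc t) ⟩
      (n * n) ℤ.⊖ suc t                                ≡⟨ ℤP.⊖-≥ (varRank< x<n y<n) ⟩
      + (n * n ∸ suc t)                                ∎
      where
      open ≡-Reasoning
      cancel : ∀ A B C → A ℤ.* ((A ℤ.+ B) ℤ.- B) ℤ.- C ≡ A ℤ.* A ℤ.- C
      cancel = solve-∀

  φ-residue : ∀ {m x y} → let n = suc m in x < n → y < n → φ-numerator n x y %ℕ (n * n) ≡ n * n ∸ suc (varRank n x y)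
  φ-residue {m} {x} {y} x<n y<n = cases (y <? x)
    where
    n : ℕ
    n = suc m
    cases : Dec (y < x) → φ-numerator n x y %ℕ (n * n) ≡ n * n ∸ suc (varRank n x y)
    cases (yes y<x) = trans (cong (_%ℕ (n * n)) (φ-numerator-unwrapped y<x)) (-[1+]%ℕ _ (n * n) (suc-varRank< y<x x<n))
    cases (no y≮x)  = trans (cong (_%ℕ (n * n)) (φ-numerator-wrapped (≮⇒≥ y≮x) y<n x<n))
                            (m<n⇒m%n≡m (∸-monoʳ-< (s≤s z≤n) (varRank< x<n y<n)))

  φ+varRank : ∀ m (i j : Fin (suc m)) → φ (suc m) i j + varRank (suc m) (toℕ i) (toℕ j) ≡ suc m * suc m
  φ+varRank m i j = begin
    suc (φ-numerator n x y %ℕ (n * n)) + t   ≡⟨ cong (λ r → suc r + t) (φ-residue (toℕ<n i) (toℕ<n j)) ⟩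
    suc (n * n ∸ suc t) + t                  ≡⟨ +-suc (n * n ∸ suc t) t ⟨
    n * n ∸ suc t + suc t                    ≡⟨ m∸n+n≡m (varRank< (toℕ<n i) (toℕ<n j)) ⟩
    n * n                                    ∎
    where
    open ≡-Reasoning
    n x y t : ℕ
    n = suc m
    x = toℕ i
    y = toℕ j
    t = varRank n x y

  φ-antitone-cyclicGap : ∀ m (i j i' j' : Fin (suc m)) →
                         cyclicGap (suc m) (toℕ i') (toℕ j') < cyclicGap (suc m) (toℕ i) (toℕ j) →
                         φ (suc m) i j < φ (suc m) i' j'
  φ-antitone-cyclicGap m i j i' j' gap'<gap = +-cancelʳ-< (varRank n (toℕ i') (toℕ j')) _ _ (begin-strict
    φ n i j + varRank n (toℕ i') (toℕ j')    <⟨ +-monoʳ-< (φ n i j) rank'<rank ⟩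
    φ n i j + varRank n (toℕ i) (toℕ j)      ≡⟨ φ+varRank m i j ⟩
    n * n                                    ≡⟨ φ+varRank m i' j' ⟨
    φ n i' j' + varRank n (toℕ i') (toℕ j')  ∎)
    where
    open ≤-Reasoning
    n : ℕ
    n = suc m
    rank'<rank : varRank n (toℕ i') (toℕ j') < varRank n (toℕ i) (toℕ j)
    rank'<rank = varRank-mono {x = toℕ i'} {x' = toℕ i} {y' = toℕ j} (toℕ<n j') gap'<gap

open VariableOrder

module LeadingMonomial where

  open import Data.Nat.Properties using (n≢0⇒n>0)
  open import Data.Nat.Induction using (<-wellFounded)
  open import Data.Fin.Properties using (¬∀⟶∃¬; any?; all?)
  open import Induction.WellFounded using (Acc; acc)
  open import Relation.Nullary.Decidable using (_×-dec_; ¬?; decidable-stable)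

  module _ {A : Set} (μ : A → ℕ) {P : A → Set} (smaller? : ∀ x → Dec (∃ λ y → μ y < μ x × P y)) where

    μ-minimal : ∀ x → P x → ∃ λ y → P y × (∀ z → μ z < μ y → ¬ P z)
    μ-minimal x px = descend x px (<-wellFounded (μ x))
      where
      descend : ∀ x → P x → Acc _<_ (μ x) → ∃ λ y → P y × (∀ z → μ z < μ y → ¬ P z)
      descend x px (acc rs) with smaller? x
      ... | yes (y , μy<μx , py) = descend y py (rs μy<μx)
      ... | no none              = x , px , λ z μz<μx pz → none (z , μz<μx , pz)

  module _ {n : ℕ} (m m' : Mono n) where

    FirstDifference : Fin n → Fin n → Set
    FirstDifference i j = m i j ≢ m' i j × (∀ k l → (k , l) ≺var (i , j) → m k l ≡ m' k l)

    ≭⇒∃≢ : ¬ m ≐ m' → ∃₂ λ i j → m i j ≢ m' i j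
    ≭⇒∃≢ m≭m' =
      let i , ¬row≐ = ¬∀⟶∃¬ n _ (λ i → all? (λ j → m i j ℕ.≟ m' i j)) m≭m'
          j , ij≢   = ¬∀⟶∃¬ n _ (λ j → m i j ℕ.≟ m' i j) ¬row≐
      in i , j , ij≢

    firstDifference : ¬ m ≐ m' → ∃₂ FirstDifference
    firstDifference m≭m' =
      let i₀ , j₀ , i₀j₀≢ = ≭⇒∃≢ m≭m'
          (i , j) , ij≢ , minimal = μ-minimal (uncurry (φ n)) smaller? (i₀ , j₀) i₀j₀≢
      in i , j , ij≢ , λ k l kl≺ij → decidable-stable (m k l ℕ.≟ m' k l) (minimal (k , l) kl≺ij)
      where
      smaller? : ∀ ij → Dec (∃ λ kl → uncurry (φ n) kl < uncurry (φ n) ij × uncurry m kl ≢ uncurry m' kl)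
      smaller? (i , j) with any? (λ k → any? (λ l → (φ n k l ℕ.<? φ n i j) ×-dec ¬? (m k l ℕ.≟ m' k l)))
      ... | yes (k , l , hit) = yes ((k , l) , hit)
      ... | no none           = no λ ((k , l) , hit) → none (k , l , hit)

  module _ {n s : ℕ} (a b : Fin s → Fin n) (τ : Fin s → Fin s) where

    Dominant : Set
    Dominant = ∀ σ → Injective _≡_ _≡_ σ → ∀ p → σ p ≢ τ p →
               ∃ λ q → σ q ≢ τ q × (a (σ q) , b q) ≺var (a (τ p) , b p)

  module _ {n s : ℕ} {a b : Fin s → Fin n} (a-inj : Injective _≡_ _≡_ a) (b-inj : Injective _≡_ _≡_ b)
           {τ : Fin s → Fin s} where

    permMono-⪯ : Dominant a b τ → ∀ m σ → Injective _≡_ _≡_ σ → m ≐ permMono a b σ → m ⪯ permMono a b τ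
    permMono-⪯ dominant m σ σ-inj m≐σ with m ≐? permMono a b τ
    ... | yes m≐τ = inj₂ m≐τ
    ... | no m≭τ  =
      let i , j , difference = firstDifference m N m≭τ
      in inj₁ (inj₂ (deg≡ , i , j , proj₁ difference , proj₂ difference , exponent< i j difference))
      where
      open ≡-Reasoning
      N : Mono n
      N = permMono a b τ
      deg≡ : deg m ≡ deg N
      deg≡ = trans (deg-resp-≐ m≐σ) (trans (deg-permMono a b σ) (sym (deg-permMono a b τ)))
      exponent<-at : ∀ p → FirstDifference m N (a (τ p)) (b p) → N (a (τ p)) (b p) < m (a (τ p)) (b p)
      exponent<-at p (differs , minimal) = contradiction 1≡0 λ ()
        where
        σp≢τp : σ p ≢ τ p
        σp≢τp σp≡τp = differs (begin
          m (a (τ p)) (b p)               ≡⟨ m≐σ _ _ ⟩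
          permMono a b σ (a (τ p)) (b p)  ≡⟨ cong (λ r → permMono a b σ (a r) (b p)) σp≡τp ⟨
          permMono a b σ (a (σ p)) (b p)  ≡⟨ permMono-on a b b-inj σ p ⟩
          1                               ≡⟨ permMono-on a b b-inj τ p ⟨
          N (a (τ p)) (b p)               ∎)
        q : Fin s
        q = proj₁ (dominant σ σ-inj p σp≢τp)
        σq≢τq : σ q ≢ τ q
        σq≢τq = proj₁ (proj₂ (dominant σ σ-inj p σp≢τp))
        q≺p : (a (σ q) , b q) ≺var (a (τ p) , b p)
        q≺p = proj₂ (proj₂ (dominant σ σ-inj p σp≢τp))
        1≡0 : 1 ≡ 0
        1≡0 = begin
          1                               ≡⟨ permMono-on a b b-inj σ q ⟨
          permMono a b σ (a (σ q)) (b q)  ≡⟨ m≐σ _ _ ⟨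
          m (a (σ q)) (b q)               ≡⟨ minimal _ _ q≺p ⟩
          N (a (σ q)) (b q)               ≡⟨ permMono-off a b b-inj τ a-inj q (σ q) (σq≢τq ∘ sym) ⟩
          0                               ∎
      -- All exponents are 0 or 1.  Where N has exponent 1, σ deviates from τ, and dominance gives a
      -- smaller variable at which m has exponent 1 and N has exponent 0.
      exponent< : ∀ i j → FirstDifference m N i j → N i j < m i j
      exponent< i j difference with N i j ℕ.≟ 0
      ... | yes Nij≡0 = subst (_< m i j) (sym Nij≡0) (n≢0⇒n>0 (proj₁ difference ∘ flip trans (sym Nij≡0)))
      ... | no Nij≢0 with permMono-support a b τ i j Nij≢0
      ...   | p , refl , refl = exponent<-at p difference

open LeadingMonomial

module CyclicShift where

  open import Data.Nat using (_+_; _∸_; _<?_; _≤?_; z≤n; s≤s)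
  open import Data.Nat.Properties
  open import Algebra.Properties.CommutativeSemigroup +-commutativeSemigroup using (x∙yz≈y∙xz)
  open import Data.Nat.DivMod using (_mod_; _%_; m<n⇒m%n≡m; [m+n]%n≡m%n)
  open import Data.Fin.Properties using (toℕ<n; toℕ-injective; toℕ-fromℕ<; ¬∀⟶∃¬; all?)
  open import Data.Empty using (⊥)
  open import Relation.Nullary.Decidable using (_→-dec_; ¬?)

  module _ {k : ℕ} (ℓ : ℕ) where

    private
      s : ℕ
      s = suc k

    rotate : Fin s → Fin s
    rotate i = (toℕ i + ℓ) mod s

    rotate-unwrapped : ∀ i → toℕ i + ℓ < s → toℕ (rotate i) ≡ toℕ i + ℓ
    rotate-unwrapped i i+ℓ<s = trans (toℕ-fromℕ< _) (m<n⇒m%n≡m i+ℓ<s)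

    module _ (ℓ≤s : ℓ ≤ s) where

      rotate-wrapped : ∀ i → s ≤ toℕ i + ℓ → toℕ (rotate i) + s ≡ toℕ i + ℓ
      rotate-wrapped i s≤i+ℓ = begin
        toℕ (rotate i) + s        ≡⟨ cong (_+ s) (toℕ-fromℕ< _) ⟩
        (toℕ i + ℓ) % s + s       ≡⟨ cong (λ z → z % s + s) (m∸n+n≡m s≤i+ℓ) ⟨
        (r + s) % s + s           ≡⟨ cong (_+ s) (trans ([m+n]%n≡m%n r s) (m<n⇒m%n≡m r<s)) ⟩
        r + s                     ≡⟨ m∸n+n≡m s≤i+ℓ ⟩
        toℕ i + ℓ                 ∎
        where
        open ≡-Reasoning
        r : ℕ
        r = toℕ i + ℓ ∸ s
        r<s : r < s
        r<s = +-cancelʳ-< s r s (subst (_< s + s) (sym (m∸n+n≡m s≤i+ℓ)) (+-mono-<-≤ (toℕ<n i) ℓ≤s))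

      rotate-wrapped<ℓ : ∀ i → s ≤ toℕ i + ℓ → toℕ (rotate i) < ℓ
      rotate-wrapped<ℓ i s≤i+ℓ =
        +-cancelʳ-< s _ ℓ (subst₂ _<_ (sym (rotate-wrapped i s≤i+ℓ)) (+-comm s ℓ) (+-monoˡ-< ℓ (toℕ<n i)))

      rotate-injective : Injective _≡_ _≡_ rotate
      rotate-injective {i} {j} eq with toℕ i + ℓ <? s | toℕ j + ℓ <? s
      ... | yes i+ℓ<s | yes j+ℓ<s = toℕ-injective (+-cancelʳ-≡ ℓ _ _
            (trans (sym (rotate-unwrapped i i+ℓ<s)) (trans (cong toℕ eq) (rotate-unwrapped j j+ℓ<s))))
      ... | no i+ℓ≮s  | no j+ℓ≮s  = toℕ-injective (+-cancelʳ-≡ ℓ _ _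
            (trans (sym (rotate-wrapped i (≮⇒≥ i+ℓ≮s)))
                   (trans (cong (λ r → toℕ r + s) eq) (rotate-wrapped j (≮⇒≥ j+ℓ≮s)))))
      ... | yes i+ℓ<s | no j+ℓ≮s  = contradiction (rotate-wrapped<ℓ j (≮⇒≥ j+ℓ≮s))
            (≤⇒≯ (subst (ℓ ≤_) (trans (sym (rotate-unwrapped i i+ℓ<s)) (cong toℕ eq)) (m≤n+m ℓ (toℕ i))))
      ... | no i+ℓ≮s  | yes j+ℓ<s = contradiction (rotate-wrapped<ℓ i (≮⇒≥ i+ℓ≮s))
            (≤⇒≯ (subst (ℓ ≤_) (trans (sym (rotate-unwrapped j j+ℓ<s)) (cong toℕ (sym eq))) (m≤n+m ℓ (toℕ j))))

  unroll : ℕ → ℕ → ℕ → ℕ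
  unroll n c z with c ≤? z
  ... | yes _ = z
  ... | no _  = n + z

  module _ {n c : ℕ} where

    unroll-≥ : ∀ {z} → c ≤ z → unroll n c z ≡ z
    unroll-≥ {z} c≤z with c ≤? z
    ... | yes _   = refl
    ... | no c≰z  = contradiction c≤z c≰z

    unroll-< : ∀ {z} → z < c → unroll n c z ≡ n + z
    unroll-< {z} z<c with c ≤? z
    ... | yes c≤z = contradiction c≤z (<⇒≱ z<c)
    ... | no _    = refl

    unroll-cases : ∀ z → unroll n c z ≡ z ⊎ unroll n c z ≡ n + z
    unroll-cases z with c ≤? z
    ... | yes _ = inj₁ refl
    ... | no _  = inj₂ refl

    c≤unroll : ∀ z → c ≤ n → c ≤ unroll n c z
    c≤unroll z c≤n with c ≤? z
    ... | yes c≤z = c≤z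
    ... | no _    = ≤-trans c≤n (m≤m+n n z)

    unroll<c+n : ∀ {z} → z < n → unroll n c z < c + n
    unroll<c+n {z} z<n with c ≤? z
    ... | yes _   = <-≤-trans z<n (m≤n+m n c)
    ... | no c≰z  = subst (n + z <_) (+-comm n c) (+-monoʳ-< n (≰⇒> c≰z))

    unroll-unique : ∀ {w z} → c ≤ w → w < c + n → w ≡ z ⊎ w ≡ n + z → w ≡ unroll n c z
    unroll-unique {w} {z} c≤w w<c+n w≡ with c ≤? z | w≡
    ... | yes _   | inj₁ w≡z   = w≡z
    ... | no _    | inj₂ w≡n+z = w≡n+z
    ... | yes c≤z | inj₂ w≡n+z =
      contradiction (subst (c + n ≤_) (sym w≡n+z) (subst (_≤ n + z) (+-comm n c) (+-monoʳ-≤ n c≤z))) (<⇒≱ w<c+n)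
    ... | no c≰z  | inj₁ w≡z   = contradiction (subst (c ≤_) w≡z c≤w) c≰z

    unroll-injective : ∀ {z z'} → z < n → z' < n → unroll n c z ≡ unroll n c z' → z ≡ z'
    unroll-injective {z} {z'} z<n z'<n eq with c ≤? z | c ≤? z'
    ... | yes _ | yes _ = eq
    ... | no _  | no _  = +-cancelˡ-≡ n _ _ eq
    ... | yes _ | no _  = contradiction (subst (n ≤_) (sym eq) (m≤m+n n z')) (<⇒≱ z<n)
    ... | no _  | yes _ = contradiction (subst (n ≤_) eq (m≤m+n n z)) (<⇒≱ z'<n)

  m+[1+n+o]≡n+[m+1+o] : ∀ m n o → m + suc (n + o) ≡ n + (m + suc o)
  m+[1+n+o]≡n+[m+1+o] m n o = trans (cong (m +_) (sym (+-suc n o))) (x∙yz≈y∙xz m n (suc o))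

  cyclicGap-unroll : ∀ {n β x y} → β < n → y < n →
                     let w = cyclicGap n x y + suc (unroll n β y) in w ≤ β + n → w ≡ unroll n (suc β) x
  cyclicGap-unroll {n} {β} {x} {y} β<n y<n w≤β+n =
    unroll-unique {n} {suc β} (≤-trans (s≤s (c≤unroll y (<⇒≤ β<n))) (m≤n+m _ g)) (s≤s w≤β+n)
                  (lift (unroll-cases {n} {β} y) (cyclicGap-cases y<n))
    where
    g = cyclicGap n x y
    w : ℕ
    w = g + suc (unroll n β y)
    w≡n+[g+1+y] : unroll n β y ≡ n + y → w ≡ n + (g + suc y)
    w≡n+[g+1+y] u≡n+y = trans (cong (λ u → g + suc u) u≡n+y) (m+[1+n+o]≡n+[m+1+o] g n y)
    lift : unroll n β y ≡ y ⊎ unroll n β y ≡ n + y → g + suc y ≡ x ⊎ g + suc y ≡ n + x → w ≡ x ⊎ w ≡ n + x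
    lift (inj₁ u≡y)   g≡ = subst (λ u → g + suc u ≡ x ⊎ g + suc u ≡ n + x) (sym u≡y) g≡
    lift (inj₂ u≡n+y) (inj₁ g+1+y≡x)   = inj₂ (trans (w≡n+[g+1+y] u≡n+y) (cong (n +_) g+1+y≡x))
    lift (inj₂ u≡n+y) (inj₂ g+1+y≡n+x) =
      contradiction (subst (_≤ β + n) (trans (w≡n+[g+1+y] u≡n+y) (cong (n +_) g+1+y≡n+x)) w≤β+n)
                    (<⇒≱ (+-mono-<-≤ β<n (m≤m+n n x)))

  module _ {s n : ℕ} {a : Fin s → Fin n} (a-inc : StrictlyIncreasing a) where

    increasing-mono : ∀ {i j} → toℕ i ≤ toℕ j → toℕ (a i) ≤ toℕ (a j)
    increasing-mono {i} {j} i≤j with m≤n⇒m<n∨m≡n i≤j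
    ... | inj₁ i<j = <⇒≤ (a-inc i j i<j)
    ... | inj₂ i≡j = ≤-reflexive (cong (toℕ ∘ a) (toℕ-injective i≡j))

    increasing-cancel : ∀ {i j} → toℕ (a i) ≤ toℕ (a j) → toℕ i ≤ toℕ j
    increasing-cancel {i} {j} ai≤aj = ≮⇒≥ (λ j<i → <⇒≱ (a-inc j i j<i) ai≤aj)

    increasing-injective : Injective _≡_ _≡_ a
    increasing-injective ai≡aj =
      toℕ-injective (≤-antisym (increasing-cancel (≤-reflexive (cong toℕ ai≡aj)))
                               (increasing-cancel (≤-reflexive (cong toℕ (sym ai≡aj)))))

  module _ {k n : ℕ} (a b : Fin (suc k) → Fin n) where

    Pivot : ℕ → Fin (suc k) → Set
    Pivot ℓ i₀ = toℕ i₀ + ℓ ≤ suc k × (∀ j → toℕ j < toℕ i₀ + ℓ → toℕ (a j) ≤ toℕ (b i₀))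

    private
      ok? : ∀ ℓ i j → Dec (toℕ j ≡ toℕ i + ℓ → toℕ (b i) < toℕ (a j))
      ok? ℓ i j = (toℕ j ℕ.≟ toℕ i + ℓ) →-dec (toℕ (b i) <? toℕ (a j))

    ¬ShiftOK⇒violation : ∀ {ℓ} → ¬ ShiftOK a b ℓ → ∃₂ λ i j → toℕ j ≡ toℕ i + ℓ × toℕ (a j) ≤ toℕ (b i)
    ¬ShiftOK⇒violation {ℓ} ¬ok with ¬∀⟶∃¬ _ _ (λ i → all? (ok? ℓ i)) ¬ok
    ... | i , ¬row with ¬∀⟶∃¬ _ _ (ok? ℓ i) ¬row
    ...   | j , ¬ij with toℕ j ℕ.≟ toℕ i + ℓ | toℕ (b i) <? toℕ (a j)
    ...     | yes j≡i+ℓ | yes bi<aj = contradiction (λ _ → bi<aj) ¬ij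
    ...     | yes j≡i+ℓ | no bi≮aj  = i , j , j≡i+ℓ , ≮⇒≥ bi≮aj
    ...     | no j≢i+ℓ  | _         = contradiction (λ j≡i+ℓ → contradiction j≡i+ℓ j≢i+ℓ) ¬ij

    leastShift⇒pivot : StrictlyIncreasing a → ∀ ℓ → IsLeastShift a b ℓ → ∃ (Pivot ℓ)
    leastShift⇒pivot _     zero     _               = Fin.zero , z≤n , λ _ ()
    leastShift⇒pivot a-inc (suc ℓ) (_ , _ , least) =
      let i , j , j≡i+ℓ , aj≤bi = ¬ShiftOK⇒violation (least ℓ ≤-refl)
          i+1+ℓ≡1+j = trans (+-suc (toℕ i) ℓ) (cong suc (sym j≡i+ℓ))
      in i , subst (_≤ suc k) (sym i+1+ℓ≡1+j) (toℕ<n j) ,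
         λ j' j'<i+1+ℓ → ≤-trans (increasing-mono a-inc {j'} {j} (≤-pred (subst (toℕ j' <_) i+1+ℓ≡1+j j'<i+1+ℓ)))
                                 aj≤bi

  module ShiftMatching {k n : ℕ} {a b : Fin (suc k) → Fin n} (a-inc : StrictlyIncreasing a) (b-inc : StrictlyIncreasing b)
                       {ℓ : ℕ} (ℓ≤s : ℓ ≤ suc k) (shiftOK : ShiftOK a b ℓ)
                       {i₀ : Fin (suc k)} (pivot : Pivot a b ℓ i₀) where

    private
      s β : ℕ
      s = suc k
      A B : Fin s → ℕ
      A = toℕ ∘ a
      B = toℕ ∘ b
      β = B i₀
      τ : Fin s → Fin s
      τ = rotate {k} ℓ

    -- Columns and rows unrolled to the windows [β, β + n) and (β, β + n].  There τ is an
    -- order-preserving matching (τ-monotone) whose gaps are differences of positions (gap-τ).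
    colPos rowPos : ℕ → ℕ
    colPos = unroll n β
    rowPos = unroll n (suc β)

    gap : (Fin s → Fin s) → Fin s → ℕ
    gap π q = cyclicGap n (A (π q)) (B q)

    data Arc (i : Fin s) : Set where
      noWrap   : β ≤ B i → B i < A (τ i) → toℕ (τ i) ≡ toℕ i + ℓ → toℕ i + ℓ < s → Arc i
      rowWraps : β ≤ B i → A (τ i) ≤ β → toℕ (τ i) + s ≡ toℕ i + ℓ → Arc i
      bothWrap : B i < β → B i < A (τ i) → A (τ i) ≤ β → toℕ (τ i) ≡ toℕ i + ℓ → Arc i

    private
      arc-wrapped : ∀ i → s ≤ toℕ i + ℓ → Arc i
      arc-wrapped i s≤i+ℓ =
        rowWraps (increasing-mono b-inc i₀≤i) (proj₂ pivot (τ i) τi<i₀+ℓ) (rotate-wrapped {k} ℓ ℓ≤s i s≤i+ℓ)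
        where
        i₀≤i : toℕ i₀ ≤ toℕ i
        i₀≤i = +-cancelʳ-≤ ℓ _ _ (≤-trans (proj₁ pivot) s≤i+ℓ)
        τi<i₀+ℓ : toℕ (τ i) < toℕ i₀ + ℓ
        τi<i₀+ℓ = <-≤-trans (rotate-wrapped<ℓ {k} ℓ ℓ≤s i s≤i+ℓ) (m≤n+m ℓ (toℕ i₀))

      arc-unwrapped : ∀ i → toℕ i + ℓ < s → Arc i
      arc-unwrapped i i+ℓ<s = byPivot (toℕ i₀ ≤? toℕ i)
        where
        τi≡ : toℕ (τ i) ≡ toℕ i + ℓ
        τi≡ = rotate-unwrapped ℓ i i+ℓ<s
        byPivot : Dec (toℕ i₀ ≤ toℕ i) → Arc i
        byPivot (yes i₀≤i) = noWrap (increasing-mono b-inc i₀≤i) (shiftOK i (τ i) τi≡) τi≡ i+ℓ<s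
        byPivot (no i₀≰i)  = bothWrap (b-inc i i₀ (≰⇒> i₀≰i)) (shiftOK i (τ i) τi≡)
                               (proj₂ pivot (τ i) (subst (_< toℕ i₀ + ℓ) (sym τi≡) (+-monoˡ-< ℓ (≰⇒> i₀≰i)))) τi≡

    arc : ∀ i → Arc i
    arc i with toℕ i + ℓ <? s
    ... | yes i+ℓ<s = arc-unwrapped i i+ℓ<s
    ... | no i+ℓ≮s  = arc-wrapped i (≮⇒≥ i+ℓ≮s)

    gap-τ : ∀ i → gap τ i + suc (colPos (B i)) ≡ rowPos (A (τ i))
    gap-τ i with arc i
    ... | noWrap β≤Bi Bi<Aτi _ _ = begin
      gap τ i + suc (colPos (B i))   ≡⟨ cong (λ u → gap τ i + suc u) (unroll-≥ β≤Bi) ⟩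
      gap τ i + suc (B i)            ≡⟨ cyclicGap-< n Bi<Aτi ⟩
      A (τ i)                        ≡⟨ unroll-≥ (≤-<-trans β≤Bi Bi<Aτi) ⟨
      rowPos (A (τ i))               ∎
      where open ≡-Reasoning
    ... | rowWraps β≤Bi Aτi≤β _ = begin
      gap τ i + suc (colPos (B i))   ≡⟨ cong (λ u → gap τ i + suc u) (unroll-≥ β≤Bi) ⟩
      gap τ i + suc (B i)            ≡⟨ cyclicGap-≥ (≤-trans Aτi≤β β≤Bi) (toℕ<n (b i)) ⟩
      n + A (τ i)                    ≡⟨ unroll-< (s≤s Aτi≤β) ⟨
      rowPos (A (τ i))               ∎
      where open ≡-Reasoning
    ... | bothWrap Bi<β Bi<Aτi Aτi≤β _ = begin
      gap τ i + suc (colPos (B i))   ≡⟨ cong (λ u → gap τ i + suc u) (unroll-< Bi<β) ⟩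
      gap τ i + suc (n + B i)        ≡⟨ m+[1+n+o]≡n+[m+1+o] (gap τ i) n (B i) ⟩
      n + (gap τ i + suc (B i))      ≡⟨ cong (n +_) (cyclicGap-< n Bi<Aτi) ⟩
      n + A (τ i)                    ≡⟨ unroll-< (s≤s Aτi≤β) ⟨
      rowPos (A (τ i))               ∎
      where open ≡-Reasoning

    private
      A-mono : ∀ {j j'} → toℕ j ≤ toℕ j' → A j ≤ A j'
      A-mono = increasing-mono a-inc

      B-cancel : ∀ d {p q} → colPos (B p) ≡ d + B p → colPos (B q) ≡ d + B q →
                 colPos (B p) ≤ colPos (B q) → toℕ p ≤ toℕ q
      B-cancel d p≡ q≡ le = increasing-cancel b-inc (+-cancelˡ-≤ d _ _ (subst₂ _≤_ p≡ q≡ le))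

      B-cancel-first : ∀ {p q} → β ≤ B p → β ≤ B q → colPos (B p) ≤ colPos (B q) → toℕ p ≤ toℕ q
      B-cancel-first β≤Bp β≤Bq = B-cancel 0 (unroll-≥ β≤Bp) (unroll-≥ β≤Bq)

      τ-mono : ∀ {p q} → toℕ (τ p) ≡ toℕ p + ℓ → toℕ (τ q) ≡ toℕ q + ℓ →
               toℕ p ≤ toℕ q → toℕ (τ p) ≤ toℕ (τ q)
      τ-mono τp≡ τq≡ p≤q = subst₂ _≤_ (sym τp≡) (sym τq≡) (+-monoˡ-≤ ℓ p≤q)

      rowPos-mono : ∀ d {x x'} → rowPos x ≡ d + x → rowPos x' ≡ d + x' → x ≤ x' → rowPos x ≤ rowPos x'
      rowPos-mono d x≡ x'≡ x≤x' = subst₂ _≤_ (sym x≡) (sym x'≡) (+-monoʳ-≤ d x≤x')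

      first≤second : ∀ {j j'} → β < A j → A j' ≤ β → rowPos (A j) ≤ rowPos (A j')
      first≤second {j} {j'} β<Aj Aj'≤β =
        subst₂ _≤_ (sym (unroll-≥ β<Aj)) (sym (unroll-< (s≤s Aj'≤β)))
                   (≤-trans (<⇒≤ (toℕ<n (a j))) (m≤m+n n (A j')))

      second≰first : ∀ {p q} → B p < β → β ≤ B q → ¬ colPos (B p) ≤ colPos (B q)
      second≰first {p} {q} Bp<β β≤Bq le =
        <⇒≱ (toℕ<n (b q)) (≤-trans (m≤m+n n (B p)) (subst₂ _≤_ (unroll-< Bp<β) (unroll-≥ β≤Bq) le))

    τ-monotone : ∀ p q → colPos (B p) ≤ colPos (B q) → rowPos (A (τ p)) ≤ rowPos (A (τ q))
    τ-monotone p q col≤ with arc p | arc q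
    ... | noWrap β≤Bp Bp<Aτp τp≡ _ | noWrap β≤Bq Bq<Aτq τq≡ _ =
      rowPos-mono 0 (unroll-≥ (≤-<-trans β≤Bp Bp<Aτp)) (unroll-≥ (≤-<-trans β≤Bq Bq<Aτq))
        (A-mono (τ-mono τp≡ τq≡ (B-cancel-first β≤Bp β≤Bq col≤)))
    ... | noWrap β≤Bp Bp<Aτp _ _ | rowWraps _ Aτq≤β _ = first≤second (≤-<-trans β≤Bp Bp<Aτp) Aτq≤β
    ... | noWrap β≤Bp Bp<Aτp _ _ | bothWrap _ _ Aτq≤β _ = first≤second (≤-<-trans β≤Bp Bp<Aτp) Aτq≤β
    ... | rowWraps β≤Bp _ τp+s≡ | noWrap β≤Bq _ _ q+ℓ<s =
      contradiction (≤-trans (m≤n+m s (toℕ (τ p))) (≤-trans (≤-reflexive τp+s≡) (+-monoˡ-≤ ℓ (B-cancel-first β≤Bp β≤Bq col≤))))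
                    (<⇒≱ q+ℓ<s)
    ... | rowWraps β≤Bp Aτp≤β τp+s≡ | rowWraps β≤Bq Aτq≤β τq+s≡ =
      rowPos-mono n (unroll-< (s≤s Aτp≤β)) (unroll-< (s≤s Aτq≤β))
        (A-mono (+-cancelʳ-≤ s _ _ (subst₂ _≤_ (sym τp+s≡) (sym τq+s≡) (+-monoˡ-≤ ℓ (B-cancel-first β≤Bp β≤Bq col≤)))))
    ... | rowWraps _ Aτp≤β τp+s≡ | bothWrap _ _ Aτq≤β τq≡ =
      rowPos-mono n (unroll-< (s≤s Aτp≤β)) (unroll-< (s≤s Aτq≤β))
        (A-mono (<⇒≤ (<-≤-trans (+-cancelʳ-< s _ ℓ (subst₂ _<_ (sym τp+s≡) (+-comm s ℓ) (+-monoˡ-< ℓ (toℕ<n p))))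
                                (subst (ℓ ≤_) (sym τq≡) (m≤n+m ℓ (toℕ q))))))
    ... | bothWrap Bp<β _ _ _ | noWrap β≤Bq _ _ _ = contradiction col≤ (second≰first Bp<β β≤Bq)
    ... | bothWrap Bp<β _ _ _ | rowWraps β≤Bq _ _ = contradiction col≤ (second≰first Bp<β β≤Bq)
    ... | bothWrap Bp<β _ Aτp≤β τp≡ | bothWrap Bq<β _ Aτq≤β τq≡ =
      rowPos-mono n (unroll-< (s≤s Aτp≤β)) (unroll-< (s≤s Aτq≤β))
        (A-mono (τ-mono τp≡ τq≡ (B-cancel n (unroll-< Bp<β) (unroll-< Bq<β) col≤)))

    private
      κ : Fin s → ℕ
      κ q = colPos (B q)

      κ-injective : ∀ {q q'} → κ q ≡ κ q' → q ≡ q'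
      κ-injective = increasing-injective b-inc ∘ toℕ-injective ∘ unroll-injective {n} {β} (toℕ<n (b _)) (toℕ<n (b _))

      rowPos∘A-injective : ∀ {j j'} → rowPos (A j) ≡ rowPos (A j') → j ≡ j'
      rowPos∘A-injective =
        increasing-injective a-inc ∘ toℕ-injective ∘ unroll-injective {n} {suc β} (toℕ<n (a _)) (toℕ<n (a _))

      β<n : β < n
      β<n = toℕ<n (b i₀)

      rowPos<β+n : ∀ j → rowPos (A j) ≤ β + n
      rowPos<β+n j = ≤-pred (unroll<c+n {n} {suc β} (toℕ<n (a j)))

    module _ {σ : Fin s → Fin s} (σ-inj : Injective _≡_ _≡_ σ) {p : Fin s} (σp≢τp : σ p ≢ τ p)
             (undominated : ∀ q → σ q ≢ τ q → gap σ q ≤ gap τ p) where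

      private
        σ-below-τp : ∀ q → σ q ≢ τ q → κ q ≤ κ p → rowPos (A (σ q)) < rowPos (A (τ p))
        σ-below-τp q σq≢τq κq≤κp = ≤∧≢⇒< (subst (_≤ rowPos (A (τ p))) w≡ w≤) w≢
          where
          w : ℕ
          w = gap σ q + suc (κ q)
          w≤ : w ≤ rowPos (A (τ p))
          w≤ = subst (w ≤_) (gap-τ p) (+-mono-≤ (undominated q σq≢τq) (s≤s κq≤κp))
          w≡ : w ≡ rowPos (A (σ q))
          w≡ = cyclicGap-unroll {x = A (σ q)} β<n (toℕ<n (b q)) (≤-trans w≤ (rowPos<β+n (τ p)))
          w≢ : rowPos (A (σ q)) ≢ rowPos (A (τ p))
          w≢ eq = σq≢τq (subst (λ r → σ q ≡ τ r) (sym q≡p) (rowPos∘A-injective eq))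
            where
            κq≮κp : ¬ κ q < κ p
            κq≮κp κq<κp = <-irrefl (trans w≡ (trans eq (sym (gap-τ p))))
                                   (+-mono-≤-< (undominated q σq≢τq) (s≤s κq<κp))
            q≡p : q ≡ p
            q≡p = κ-injective (≤∧≮⇒≡ κq≤κp κq≮κp)

        descend : ∀ q → κ q ≤ κ p → ∃ λ q' → κ q' < κ p × σ q ≡ τ q'
        descend q κq≤κp with injective⇒surjective τ (rotate-injective {k} ℓ ℓ≤s) (σ q) | σ q Fin.≟ τ q
        ... | q' , τq'≡σq | yes σq≡τq = q' , subst (λ r → κ r < κ p) (sym q'≡q) κq<κp , sym τq'≡σq
          where
          q'≡q : q' ≡ q
          q'≡q = rotate-injective {k} ℓ ℓ≤s (trans τq'≡σq σq≡τq)
          κq<κp : κ q < κ p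
          κq<κp = ≤∧≢⇒< κq≤κp (λ κq≡κp → σp≢τp (subst (λ r → σ r ≡ τ r) (κ-injective κq≡κp) σq≡τq))
        ... | q' , τq'≡σq | no σq≢τq = q' , ≰⇒> κp≰κq' , sym τq'≡σq
          where
          κp≰κq' : ¬ κ p ≤ κ q'
          κp≰κq' κp≤κq' = <⇒≱ (σ-below-τp q σq≢τq κq≤κp)
                                (subst (λ r → rowPos (A (τ p)) ≤ rowPos (A r)) τq'≡σq (τ-monotone p q' κp≤κq'))

      undominated-absurd : ⊥
      undominated-absurd = no-descent σ-inj κ p descend

    τ-dominant : ∀ σ → Injective _≡_ _≡_ σ → ∀ p → σ p ≢ τ p → ∃ λ q → σ q ≢ τ q × gap τ p < gap σ q
    τ-dominant σ σ-inj p σp≢τp = q , σq≢τq , gap<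
      where
      dominated? : ∀ q → Dec (σ q ≢ τ q → gap σ q ≤ gap τ p)
      dominated? q = ¬? (σ q Fin.≟ τ q) →-dec (gap σ q ≤? gap τ p)
      witness : ∃ λ q → ¬ (σ q ≢ τ q → gap σ q ≤ gap τ p)
      witness = ¬∀⟶∃¬ s _ dominated? (undominated-absurd σ-inj σp≢τp)
      q : Fin s
      q = proj₁ witness
      σq≢τq : σ q ≢ τ q
      σq≢τq σq≡τq = proj₂ witness (λ σq≢τq → contradiction σq≡τq σq≢τq)
      gap< : gap τ p < gap σ q
      gap< = ≰⇒> (λ gap≤ → proj₂ witness (λ _ → gap≤))

open CyclicShift

theorem7p2 : ∀ {c ℓ'} (K : Field c ℓ') (n : ℕ) → 1 ≤ n → (k : ℕ) → k < n →
    (a b : Fin (suc k) → Fin n) → StrictlyIncreasing a → StrictlyIncreasing b →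
    (ℓ : ℕ) → IsLeastShift a b ℓ →
    Poly.IsLeadingMonomial K (Poly.det K (suc k) (subM K a b)) (NMono a b ℓ)
theorem7p2 K (suc m) _ k _ a b a-inc b-inc ℓ least@(ℓ≤s , shiftOK , _) =
  IsSign-≉0 (coeff-det-permMono (suc k) a b a-inj b-inj τ τ-inj) , leading
  where
  open Field K using (_≈_; 0#)
  open Poly K using (coeff; det)
  open Determinant K
  a-inj : Injective _≡_ _≡_ a
  a-inj = increasing-injective a-inc
  b-inj : Injective _≡_ _≡_ b
  b-inj = increasing-injective b-inc
  τ : Fin (suc k) → Fin (suc k)
  τ = rotate {k} ℓ
  τ-inj : Injective _≡_ _≡_ τ
  τ-inj = rotate-injective ℓ ℓ≤s
  open ShiftMatching a-inc b-inc ℓ≤s shiftOK (proj₂ (leastShift⇒pivot a b a-inc ℓ least))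
  dominant : Dominant a b τ
  dominant σ σ-inj p σp≢τp =
    let q , σq≢τq , gap< = τ-dominant σ σ-inj p σp≢τp
    in q , σq≢τq , φ-antitone-cyclicGap m (a (σ q)) (b q) (a (τ p)) (b p) gap<
  leading : ∀ m' → ¬ coeff (det (suc k) (subM K a b)) m' ≈ 0# → m' ⪯ NMono a b ℓ
  leading m' ≉0 =
    let (σ , σ-inj , t≐σ) , t≐m' = lookupAny (det-support (suc k) a b) (coeff≉0⇒occurs _ m' ≉0)
    in permMono-⪯ a-inj b-inj dominant m' σ σ-inj (≐-trans (≐-sym t≐m') t≐σ)
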